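{- For every positive integer $n$, the linear map $\gamma$ from the space of binary Steinhaus triangles of size $2n-1$ to the space $\mathcal{PT}(n)$ of binary generalized Pascal triangles of size $n$ is an isomorphism.
   Context: A binary Steinhaus triangle of size $N$ is an array $(a_{i,j})_{1\le i\le j\le N}$ of elements of $\{0,1\}$ with $a_{i,j}\equiv a_{i-1,j-1}+a_{i-1,j}\pmod 2$ for $2\le i\le j\le N$. A generalized Pascal triangle of size $n$ is an array $(a_{i,j})_{1\le j\le i\le n}$ of elements of $\{0,1\}$ with $a_{i,j}\equiv a_{i-1,j-1}+a_{i-1,j}\pmod 2$ for $2\le j<i\le n$. Both kinds of triangles form vector spaces over $\mathbb{Z}/2\mathbb{Z}$ under entrywise addition. The map $\gamma$ sends a Steinhaus triangle $(a_{i,j})_{1\le i\le j\le 2n-1}$ to $(a_{i,n-1+j})_{1\le j\le i\le n}$. -}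

module Defs where

open import Data.Bool using (Bool; _xor_)
open import Data.Nat using (ℕ; _+_; _∸_; _*_; _≤_; _<_)
open import Data.Product using (Σ; _×_)
open import Relation.Binary.PropositionalEquality using (_≡_)

-- A triangular array with 1-based indices (i , j) ↦ a i j.
-- Only the entries in the relevant index range matter; entries outside
-- are ignored by the equality relations below.
Array : Set
Array = ℕ → ℕ → Bool

IsSteinhaus : ℕ → Array → Set
IsSteinhaus N a = ∀ i j → 2 ≤ i → i ≤ j → j ≤ N →
  a i j ≡ (a (i ∸ 1) (j ∸ 1) xor a (i ∸ 1) j)

SteinhausEq : ℕ → Array → Array → Set
SteinhausEq N a b = ∀ i j → 1 ≤ i → i ≤ j → j ≤ N → a i j ≡ b i j

IsPascal : ℕ → Array → Set
IsPascal n a = ∀ i j → 2 ≤ j → j < i → i ≤ n →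
  a i j ≡ (a (i ∸ 1) (j ∸ 1) xor a (i ∸ 1) j)

PascalEq : ℕ → Array → Array → Set
PascalEq n a b = ∀ i j → 1 ≤ j → j ≤ i → i ≤ n → a i j ≡ b i j

_⊕_ : Array → Array → Array
(a ⊕ b) i j = a i j xor b i j

infixl 6 _⊕_

γ : ℕ → Array → Array
γ n a i j = a i ((n ∸ 1) + j)

size : ℕ → ℕ
size n = 2 * n ∸ 1

module Submission where

-- Write n = m + 1, so the source triangles have size N = 2m + 1 and γ reads the
-- entries a(i , m + j), 1 ≤ j ≤ i ≤ m + 1.  Over Z/2 the local rule c = a + b can be
-- solved for any one of its three entries; hence
--   * a Steinhaus triangle is determined by its first row (rows propagate down), and
--   * a row is determined by the row below it together with any single entry.
-- Injectivity: row m + 1 of a Steinhaus triangle is the last row of its image;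
-- climbing upwards, row i is fixed by row i + 1 and its entry in column m + 1, which
-- is the image entry (i , 1).  So two triangles with equal images have equal first
-- rows, hence are equal.  Surjectivity runs the same climb constructively: starting
-- from the last row of the Pascal triangle, each row above is the "antiderivative"
-- of the row below, anchored in column m + 1 by the left border of the Pascal
-- triangle; the first row obtained generates a Steinhaus triangle with the given
-- image.

open import Defs
open import Data.Bool using (Bool; false; _xor_)
open import Data.Bool.Properties using (xor-assoc; xor-same; xor-identityʳ)
open import Data.Nat using (ℕ; zero; suc; _+_; _∸_; _≤_; _<_; z≤n; s≤s)
open import Data.Nat.Properties
open import Data.Product using (Σ; _×_; _,_)
open import Data.Sum using (inj₁; inj₂)
open import Relation.Binary.PropositionalEquality
open ≡-Reasoning

xor-cancelˡ : ∀ x y → x xor (x xor y) ≡ y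
xor-cancelˡ x y = begin
  x xor (x xor y) ≡⟨ sym (xor-assoc x x y) ⟩
  (x xor x) xor y ≡⟨ cong (_xor y) (xor-same x) ⟩
  y               ∎

xor-cancelʳ : ∀ x y → (x xor y) xor y ≡ x
xor-cancelʳ x y = begin
  (x xor y) xor y ≡⟨ xor-assoc x y y ⟩
  x xor (y xor y) ≡⟨ cong (x xor_) (xor-same y) ⟩
  x xor false     ≡⟨ xor-identityʳ x ⟩
  x               ∎

solve-right : ∀ x {y z} → z ≡ x xor y → y ≡ x xor z
solve-right x {y} refl = sym (xor-cancelˡ x y)

solve-left : ∀ {x y z} → z ≡ x xor y → x ≡ z xor y
solve-left {x} {y} refl = sym (xor-cancelʳ x y)

module _ (Q : ℕ → Set) {lo : ℕ} where

  ascend : ∀ {hi} → Q lo → (∀ k → lo ≤ k → k < hi → Q k → Q (suc k)) →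
           ∀ k → lo ≤ k → k ≤ hi → Q k
  ascend Qlo step zero lo≤0 _ = subst Q (n≤0⇒n≡0 lo≤0) Qlo
  ascend Qlo step (suc k) lo≤k k<hi with m≤n⇒m<n∨m≡n lo≤k
  ... | inj₂ lo≡k = subst Q lo≡k Qlo
  ... | inj₁ (s≤s lo≤k′) =
    step k lo≤k′ k<hi (ascend Qlo step k lo≤k′ (<⇒≤ k<hi))

  descend : ∀ {hi} → Q hi → (∀ k → lo ≤ k → k < hi → Q (suc k) → Q k) →
            ∀ k → lo ≤ k → k ≤ hi → Q k
  descend {zero} Qhi step k _ k≤0 = subst Q (sym (n≤0⇒n≡0 k≤0)) Qhi
  descend {suc h} Qhi step k lo≤k k≤hi with m≤n⇒m<n∨m≡n k≤hi
  ... | inj₂ k≡hi = subst Q (sym k≡hi) Qhi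
  ... | inj₁ (s≤s k≤h) =
    descend (step h (≤-trans lo≤k k≤h) ≤-refl Qhi)
            (λ j lo≤j j<h → step j lo≤j (m<n⇒m<1+n j<h)) k lo≤k k≤h

  spread : ∀ {c hi} → lo ≤ c → c ≤ hi → Q c →
           (∀ k → lo ≤ k → k < hi → Q k → Q (suc k)) →
           (∀ k → lo ≤ k → k < hi → Q (suc k) → Q k) →
           ∀ k → lo ≤ k → k ≤ hi → Q k
  spread lo≤c c≤hi Qc up down = ascend (descend Qc down′ lo ≤-refl lo≤c) up
    where
    down′ : ∀ k → lo ≤ k → k < _ → Q (suc k) → Q k
    down′ k lo≤k k<c = down k lo≤k (≤-trans k<c c≤hi)

Row : Set
Row = ℕ → Bool

SteinhausUpTo : ℕ → ℕ → Array → Set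
SteinhausUpTo h N a = ∀ i j → 2 ≤ i → i ≤ h → i ≤ j → j ≤ N →
  a i j ≡ (a (i ∸ 1) (j ∸ 1) xor a (i ∸ 1) j)

steinhaus⇒upTo : ∀ {N a} h → IsSteinhaus N a → SteinhausUpTo h N a
steinhaus⇒upTo h S i j 2≤i _ = S i j 2≤i

RowAgree : ℕ → Array → Array → ℕ → Set
RowAgree N a b i = ∀ j → i ≤ j → j ≤ N → a i j ≡ b i j

firstRowDetermines : ∀ {h N a b} → SteinhausUpTo h N a → SteinhausUpTo h N b →
  RowAgree N a b 1 → ∀ i → 1 ≤ i → i ≤ h → RowAgree N a b i
firstRowDetermines {h} {N} {a} {b} Sa Sb firstRow = ascend (RowAgree N a b) firstRow next
  where
  next : ∀ i → 1 ≤ i → i < h → RowAgree N a b i → RowAgree N a b (suc i)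
  next i _ _ _ zero ()
  next i 1≤i i<h row (suc j) (s≤s i≤j) j<N = begin
    a (suc i) (suc j)     ≡⟨ Sa (suc i) (suc j) (s≤s 1≤i) i<h (s≤s i≤j) j<N ⟩
    a i j xor a i (suc j) ≡⟨ cong₂ _xor_ (row j i≤j (<⇒≤ j<N))
                                          (row (suc j) (m≤n⇒m≤1+n i≤j) j<N) ⟩
    b i j xor b i (suc j) ≡⟨ sym (Sb (suc i) (suc j) (s≤s 1≤i) i<h (s≤s i≤j) j<N) ⟩
    b (suc i) (suc j)     ∎

-- The Steinhaus triangle with first row r (row 0 lies outside every triangle).
fromFirstRow : Row → Array
fromFirstRow r zero = r
fromFirstRow r (suc zero) = r
fromFirstRow r (suc (suc i)) j = fromFirstRow r (suc i) (j ∸ 1) xor fromFirstRow r (suc i) j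

fromFirstRow-steinhaus : ∀ N r → IsSteinhaus N (fromFirstRow r)
fromFirstRow-steinhaus N r zero j () _ _
fromFirstRow-steinhaus N r (suc zero) j (s≤s ()) _ _
fromFirstRow-steinhaus N r (suc (suc i)) j _ _ _ = refl

prefix : Row → Row
prefix s zero = false
prefix s (suc k) = prefix s k xor s (suc k)

-- The row r with r c = v whose neighbouring sums r (k-1) + r k are s k for k ≥ 1:
-- the row lying above s in a Steinhaus triangle, pinned down by its entry in column c.
rowAbove : Row → ℕ → Bool → Row
rowAbove s c v k = (v xor prefix s c) xor prefix s k

rowAbove-anchor : ∀ s c v → rowAbove s c v c ≡ v
rowAbove-anchor s c v = xor-cancelʳ v (prefix s c)

rowAbove-step : ∀ s c v k → rowAbove s c v (suc k) ≡ rowAbove s c v k xor s (suc k)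
rowAbove-step s c v k = sym (xor-assoc (v xor prefix s c) (prefix s k) (s (suc k)))

rowAbove-below : ∀ s c v k → rowAbove s c v k xor rowAbove s c v (suc k) ≡ s (suc k)
rowAbove-below s c v k = trans (cong (rowAbove s c v k xor_) (rowAbove-step s c v k))
                               (xor-cancelˡ (rowAbove s c v k) (s (suc k)))

size-suc : ∀ m → size (suc m) ≡ m + suc m
size-suc m = cong (m +_) (+-identityʳ (suc m))

middle≤column : ∀ m {j} → 1 ≤ j → suc m ≤ m + j
middle≤column m {j} 1≤j = subst (_≤ m + j) (+-comm m 1) (+-monoʳ-≤ m 1≤j)

column≤size : ∀ m {j} → j ≤ suc m → m + j ≤ size (suc m)
column≤size m {j} j≤ = subst (m + j ≤_) (sym (size-suc m)) (+-monoʳ-≤ m j≤)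

γ-pascal : ∀ m a → IsSteinhaus (size (suc m)) a → IsPascal (suc m) (γ (suc m) a)
γ-pascal m a S i j 2≤j j<i i≤n = begin
  a i (m + j)
    ≡⟨ S i (m + j) 2≤i i≤column (column≤size m (≤-trans (<⇒≤ j<i) i≤n)) ⟩
  a (i ∸ 1) (m + j ∸ 1) xor a (i ∸ 1) (m + j)
    ≡⟨ cong (λ c → a (i ∸ 1) c xor a (i ∸ 1) (m + j)) (+-∸-assoc m 1≤j) ⟩
  a (i ∸ 1) (m + (j ∸ 1)) xor a (i ∸ 1) (m + j) ∎
  where
  1≤j : 1 ≤ j
  1≤j = ≤-trans (s≤s z≤n) 2≤j
  2≤i : 2 ≤ i
  2≤i = ≤-trans 2≤j (<⇒≤ j<i)
  i≤column : i ≤ m + j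
  i≤column = ≤-trans i≤n (middle≤column m 1≤j)

module Injectivity (m : ℕ) (a b : Array)
  (Sa : IsSteinhaus (size (suc m)) a) (Sb : IsSteinhaus (size (suc m)) b)
  (same : PascalEq (suc m) (γ (suc m) a) (γ (suc m) b)) where

  N : ℕ
  N = size (suc m)

  -- Row m + 1 of a triangle is the last row of its image.
  lastRowAgrees : RowAgree N a b (suc m)
  lastRowAgrees k m<k k≤N =
    subst (λ c → a (suc m) c ≡ b (suc m) c) (m+[n∸m]≡n (<⇒≤ m<k))
      (same (suc m) (k ∸ m) (m<n⇒0<n∸m m<k) k∸m≤n ≤-refl)
    where
    k∸m≤n : k ∸ m ≤ suc m
    k∸m≤n = m≤n+o⇒m∸n≤o k m (subst (k ≤_) (size-suc m) k≤N)

  -- Row i is fixed by row i + 1 and by its entry in column m + 1, the image entry (i , 1).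
  rowAgreesAbove : ∀ i → 1 ≤ i → i < suc m → RowAgree N a b (suc i) → RowAgree N a b i
  rowAgreesAbove i 1≤i i<n below =
    spread (λ k → a i k ≡ b i k) i≤middle (column≤size m (s≤s z≤n))
      (same i 1 ≤-refl 1≤i (<⇒≤ i<n)) rightwards leftwards
    where
    i≤middle : i ≤ m + 1
    i≤middle = ≤-trans (<⇒≤ i<n) (middle≤column m ≤-refl)
    rule : ∀ {c} → IsSteinhaus N c → ∀ k → i ≤ k → k < N →
           c (suc i) (suc k) ≡ c i k xor c i (suc k)
    rule S k i≤k k<N = S (suc i) (suc k) (s≤s 1≤i) (s≤s i≤k) k<N
    rightwards : ∀ k → i ≤ k → k < N → a i k ≡ b i k → a i (suc k) ≡ b i (suc k)
    rightwards k i≤k k<N eq = begin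
      a i (suc k)                 ≡⟨ solve-right (a i k) (rule Sa k i≤k k<N) ⟩
      a i k xor a (suc i) (suc k) ≡⟨ cong₂ _xor_ eq (below (suc k) (s≤s i≤k) k<N) ⟩
      b i k xor b (suc i) (suc k) ≡⟨ sym (solve-right (b i k) (rule Sb k i≤k k<N)) ⟩
      b i (suc k)                 ∎
    leftwards : ∀ k → i ≤ k → k < N → a i (suc k) ≡ b i (suc k) → a i k ≡ b i k
    leftwards k i≤k k<N eq = begin
      a i k                             ≡⟨ solve-left (rule Sa k i≤k k<N) ⟩
      a (suc i) (suc k) xor a i (suc k) ≡⟨ cong₂ _xor_ (below (suc k) (s≤s i≤k) k<N) eq ⟩
      b (suc i) (suc k) xor b i (suc k) ≡⟨ sym (solve-left (rule Sb k i≤k k<N)) ⟩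
      b i k                             ∎

  firstRowAgrees : RowAgree N a b 1
  firstRowAgrees = descend (RowAgree N a b) lastRowAgrees rowAgreesAbove 1 ≤-refl (s≤s z≤n)

  injective : SteinhausEq N a b
  injective i j 1≤i i≤j j≤N =
    firstRowDetermines (steinhaus⇒upTo N Sa) (steinhaus⇒upTo N Sb) firstRowAgrees
      i 1≤i (≤-trans i≤j j≤N) j i≤j j≤N

module Surjectivity (m : ℕ) (p : Array) (P : IsPascal (suc m) p) where

  N : ℕ
  N = size (suc m)

  -- climb t i is row i of the triangle to be built, obtained from the last row m + 1 of
  -- the Pascal triangle in t steps upwards (meaningful when t + i = m + 1); each step
  -- anchors column m + 1 at the left border entry p(i , 1).
  climb : ℕ → ℕ → Row
  climb zero i k = p (suc m) (k ∸ m)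
  climb (suc t) i = rowAbove (climb t (suc i)) (m + 1) (p i 1)

  climb-pascal : ∀ t i j → t + i ≡ suc m → 1 ≤ j → j ≤ i → climb t i (m + j) ≡ p i j
  climb-pascal zero .(suc m) j refl _ _ = cong (p (suc m)) (m+n∸m≡n m j)
  climb-pascal (suc t) i zero _ () _
  climb-pascal (suc t) i (suc zero) _ _ _ = rowAbove-anchor (climb t (suc i)) (m + 1) (p i 1)
  climb-pascal (suc t) i (suc (suc j)) t+i≡ _ j<i = begin
    climb (suc t) i (m + suc (suc j))
      ≡⟨ cong (climb (suc t) i) (+-suc m (suc j)) ⟩
    climb (suc t) i (suc (m + suc j))
      ≡⟨ rowAbove-step (climb t (suc i)) (m + 1) (p i 1) (m + suc j) ⟩
    climb (suc t) i (m + suc j) xor climb t (suc i) (suc (m + suc j))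
      ≡⟨ cong₂ _xor_ (climb-pascal (suc t) i (suc j) t+i≡ (s≤s z≤n) (<⇒≤ j<i)) belowEntry ⟩
    p i (suc j) xor p (suc i) (suc (suc j))
      ≡⟨ sym (solve-right (p i (suc j)) pascalRule) ⟩
    p i (suc (suc j)) ∎
    where
    t+i′≡ : t + suc i ≡ suc m
    t+i′≡ = trans (+-suc t i) t+i≡
    i<n : suc i ≤ suc m
    i<n = subst (suc i ≤_) t+i′≡ (m≤n+m (suc i) t)
    pascalRule : p (suc i) (suc (suc j)) ≡ p i (suc j) xor p i (suc (suc j))
    pascalRule = P (suc i) (suc (suc j)) (s≤s (s≤s z≤n)) (s≤s j<i) i<n
    belowEntry : climb t (suc i) (suc (m + suc j)) ≡ p (suc i) (suc (suc j))
    belowEntry = trans (cong (climb t (suc i)) (sym (+-suc m (suc j))))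
                       (climb-pascal t (suc i) (suc (suc j)) t+i′≡ (s≤s z≤n) (m≤n⇒m≤1+n j<i))

  upperRows : Array
  upperRows i = climb (suc m ∸ i) i

  upperRows-steinhaus : SteinhausUpTo (suc m) N upperRows
  upperRows-steinhaus zero _ () _ _ _
  upperRows-steinhaus (suc i) zero _ _ () _
  upperRows-steinhaus (suc i) (suc j) _ (s≤s i≤m) _ _ rewrite +-∸-assoc 1 i≤m =
    sym (rowAbove-below (climb (m ∸ i) (suc i)) (m + 1) (p i 1) j)

  solution : Array
  solution = fromFirstRow (upperRows 1)

  solution-upper : ∀ i → 1 ≤ i → i ≤ suc m → RowAgree N solution upperRows i
  solution-upper = firstRowDetermines
    (steinhaus⇒upTo (suc m) (fromFirstRow-steinhaus N (upperRows 1))) upperRows-steinhaus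
    (λ _ _ _ → refl)

  solution-image : PascalEq (suc m) (γ (suc m) solution) p
  solution-image i j 1≤j j≤i i≤n = begin
    solution i (m + j)          ≡⟨ solution-upper i (≤-trans 1≤j j≤i) i≤n (m + j)
                                     (≤-trans i≤n (middle≤column m 1≤j))
                                     (column≤size m (≤-trans j≤i i≤n)) ⟩
    climb (suc m ∸ i) i (m + j) ≡⟨ climb-pascal (suc m ∸ i) i j (m∸n+n≡m i≤n) 1≤j j≤i ⟩
    p i j                       ∎

  surjective : Σ Array (λ a → IsSteinhaus N a × PascalEq (suc m) (γ (suc m) a) p)
  surjective = solution , fromFirstRow-steinhaus N (upperRows 1) , solution-image

mainTheorem19 : (n : ℕ) → 1 ≤ n →
    ((a : Array) → IsSteinhaus (size n) a → IsPascal n (γ n a))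
    × ((a b : Array) → IsSteinhaus (size n) a → IsSteinhaus (size n) b →
    PascalEq n (γ n (a ⊕ b)) (γ n a ⊕ γ n b))
    × ((a b : Array) → IsSteinhaus (size n) a → IsSteinhaus (size n) b →
    PascalEq n (γ n a) (γ n b) → SteinhausEq (size n) a b)
    × ((p : Array) → IsPascal n p →
    Σ Array (λ a → IsSteinhaus (size n) a × PascalEq n (γ n a) p))
mainTheorem19 zero ()
mainTheorem19 (suc m) _ =
    γ-pascal m
  , (λ _ _ _ _ _ _ _ _ _ → refl)
  , (λ a b Sa Sb same → Injectivity.injective m a b Sa Sb same)
  , (λ p P → Surjectivity.surjective m p P)
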